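{- Let $G$ be a finite directed graph and let $H$ be a full subgraph of $G$. Then $\mathrm{Ind}_G(H)=\dfrac{\mathrm{Ind}_G(1)}{\mathrm{Ind}_H(1)}$, where $1$ denotes the trivial graph (one vertex, no edges).
   Context: Finite directed graphs may have loop-edges and multiple edges; all graphs have nonempty vertex set. A full subgraph $H$ of $G$ is given by a subset $V(H)\subseteq V(G)$ together with $E(H)=$ the set of all edges of $G$ whose initial and terminal vertices both lie in $V(H)$. For a finite directed graph $K$ write $|K|=|V(K)\cup E(K)|=|V(K)|+|E(K)|$. The subgraph boundary quotient graph $G/\partial_H$ (where $\partial_H=V(H)\cup E(H)$) is the graph with vertex set $\{v_{\partial_H}\}\cup(V(G)\setminus V(H))$ and edge set $E(G)\setminus E(H)$, obtained by collapsing all of $V(H)\cup E(H)$ to a single new vertex $v_{\partial_H}$ (endpoints in $V(H)$ of remaining edges are replaced by $v_{\partial_H}$). The subgraph boundary index is $\mathrm{Ind}_G(H)=\exp(|G/\partial_H|-1)$. For the trivial graph $1$, collapsing a single edgeless vertex leaves $K$ unchanged, so $\mathrm{Ind}_K(1)=\exp(|K|-1)$ for every finite directed graph $K$. -}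

module Defs where

open import Data.Nat using (ℕ; suc; _+_)
open import Data.Integer using (ℤ; +_; _-_)
open import Data.Fin using (Fin)
open import Data.Fin.Subset using (Subset; _∈_; _∉_; ∣_∣; Nonempty)
open import Data.Fin.Subset.Properties using (_∈?_)
open import Data.List using (List; []; _∷_; length; filter; map; allFin)
open import Data.Maybe using (Maybe; just; nothing)
open import Data.Product using (_×_)
open import Relation.Nullary using (¬_; ¬?)
open import Relation.Nullary.Decidable using (_×-dec_)

record Graph : Set where
  field
    n   : ℕ
    m   : ℕ
    src : Fin m → Fin (suc n)
    tgt : Fin m → Fin (suc n)
open Graph public


size : Graph → ℕ
size G = suc (n G) + m G

-- A full subgraph of G: a nonempty vertex subset; its edges are all edges
-- of G with both endpoints in that subset.
record FullSubgraph (G : Graph) : Set where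
  field
    verts    : Subset (suc (n G))
    nonempty : Nonempty verts
open FullSubgraph public

InH : (G : Graph) → FullSubgraph G → Fin (m G) → Set
InH G H e = (src G e ∈ verts H) × (tgt G e ∈ verts H)

edgesH : (G : Graph) → FullSubgraph G → List (Fin (m G))
edgesH G H = filter (λ e → (src G e ∈? verts H) ×-dec (tgt G e ∈? verts H)) (allFin (m G))

sizeSub : (G : Graph) → FullSubgraph G → ℕ
sizeSub G H = ∣ verts H ∣ + length (edgesH G H)

-- The subgraph boundary quotient graph G/∂_H: vertex set
-- {v_∂H} ∪ (V(G) \ V(H)) (the new vertex is `nothing`), edge set E(G) \ E(H),
-- endpoints in V(H) replaced by the new vertex.
record QuotientGraph : Set₁ where
  field
    Vtx   : Set
    Edg   : Set
    vlist : List Vtx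
    elist : List Edg
    qsrc  : Edg → Vtx
    qtgt  : Edg → Vtx

collapse : (G : Graph) → FullSubgraph G → Fin (suc (n G)) → Maybe (Fin (suc (n G)))
collapse G H v with v ∈? verts H
... | Relation.Nullary.yes _ = nothing
... | Relation.Nullary.no _  = just v

quotient : (G : Graph) → FullSubgraph G → QuotientGraph
quotient G H = record
  { Vtx   = Maybe (Fin (suc (n G)))
  ; Edg   = Fin (m G)
  ; vlist = nothing ∷ map just (filter (λ v → ¬? (v ∈? verts H)) (allFin (suc (n G))))
  ; elist = filter (λ e → ¬? ((src G e ∈? verts H) ×-dec (tgt G e ∈? verts H))) (allFin (m G))
  ; qsrc  = λ e → collapse G H (src G e)
  ; qtgt  = λ e → collapse G H (tgt G e)
  }

sizeQ : QuotientGraph → ℕ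
sizeQ Q = length (QuotientGraph.vlist Q) + length (QuotientGraph.elist Q)

-- Indices are of the form exp(k) with k ∈ ℤ; since exp is injective and
-- exp a / exp b = exp (a - b), we represent an index by its exponent k.
-- logInd G H = |G/∂_H| - 1, i.e. Ind_G(H) = exp(logInd G H).
logInd : (G : Graph) → FullSubgraph G → ℤ
logInd G H = + sizeQ (quotient G H) - + 1

-- Ind_K(1) = exp(|K| - 1); exponents for K = G and K = H.
logIndTrivial : Graph → ℤ
logIndTrivial G = + size G - + 1

logIndTrivialSub : (G : Graph) → FullSubgraph G → ℤ
logIndTrivialSub G H = + sizeSub G H - + 1

{-# OPTIONS --safe #-}
module Submission where

-- Collapsing H removes exactly its |V(H)| vertices and |E(H)| edges and adds one
-- new vertex, so |G/∂_H| + |H| = |G| + 1.  Taking exponents, the index Ind_G(H)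
-- is exp(|G| - |H|) = exp(|G| - 1) / exp(|H| - 1).

open import Defs
open import Data.Bool using (true; false)
open import Data.Fin using (Fin; zero; suc)
open import Data.Fin.Subset using (Subset; inside; outside; ∣_∣)
open import Data.Fin.Subset.Properties using (_∈?_)
open import Data.Integer as ℤ using (ℤ; +_; _-_)
import Data.Integer.Properties as ℤP
open import Data.Integer.Tactic.RingSolver using (solve-∀)
open import Data.List using (List; []; _∷_; length; filter; tabulate; allFin)
open import Data.List.Properties using (length-map; length-tabulate)
open import Data.Maybe using (just)
open import Data.Nat using (suc; _+_)
import Data.Nat.Properties as ℕP
open import Algebra.Properties.CommutativeSemigroup ℕP.+-commutativeSemigroup
  using (interchange)
open import Data.Vec using ([]; _∷_)
open import Function using (id)
open import Level using (Level)
open import Relation.Binary.PropositionalEquality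
  using (_≡_; refl; trans; cong; cong₂; module ≡-Reasoning)
open import Relation.Nullary using (does)
open import Relation.Unary using (Pred; Decidable)
open import Relation.Unary.Properties using (∁?)

open ≡-Reasoning

module _ {a p : Level} {A : Set a} {P : Pred A p} (P? : Decidable P) where

  length-filter-∁+length-filter : ∀ (xs : List A) →
    length (filter (∁? P?) xs) + length (filter P? xs) ≡ length xs
  length-filter-∁+length-filter []       = refl
  length-filter-∁+length-filter (x ∷ xs) with does (P? x)
  ... | true  = trans (ℕP.+-suc _ _) (cong suc (length-filter-∁+length-filter xs))
  ... | false = cong suc (length-filter-∁+length-filter xs)

  length-filter-tabulate : ∀ {n} (q : Subset n) (f : Fin n → A) →
    (∀ i → does (P? (f i)) ≡ does (i ∈? q)) →
    length (filter P? (tabulate f)) ≡ ∣ q ∣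
  length-filter-tabulate []      f agree = refl
  length-filter-tabulate (x ∷ q) f agree with does (P? (f zero)) | agree zero
  length-filter-tabulate (inside ∷ q) f agree | true | refl =
    cong suc (length-filter-tabulate q (λ i → f (suc i)) (λ i → agree (suc i)))
  length-filter-tabulate (outside ∷ q) f agree | false | refl =
    length-filter-tabulate q (λ i → f (suc i)) (λ i → agree (suc i))

m+n≡1+k⇒m-1≡[k-1]-[n-1] : ∀ {m n k} → m + n ≡ suc k →
  + m - + 1 ≡ (+ k - + 1) - (+ n - + 1)
m+n≡1+k⇒m-1≡[k-1]-[n-1] {m} {n} {k} m+n≡1+k = begin
  + m - + 1                          ≡⟨ regroup (+ m) (+ n) (+ k) ⟩
  rhs ℤ.+ (+ (m + n) - + suc k)      ≡⟨ cong (λ z → rhs ℤ.+ (+ z - + suc k)) m+n≡1+k ⟩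
  rhs ℤ.+ (+ suc k - + suc k)        ≡⟨ cong (λ z → rhs ℤ.+ z) (ℤP.+-inverseʳ (+ suc k)) ⟩
  rhs ℤ.+ + 0                        ≡⟨ ℤP.+-identityʳ rhs ⟩
  rhs                                ∎
  where
  rhs : ℤ
  rhs = (+ k - + 1) - (+ n - + 1)

  regroup : ∀ (x y z : ℤ) → x - + 1 ≡ ((z - + 1) - (y - + 1)) ℤ.+ ((x ℤ.+ y) - (+ 1 ℤ.+ z))
  regroup = solve-∀

module _ (G : Graph) (H : FullSubgraph G) where

  private
    outsideH : List (Fin (suc (n G)))
    outsideH = filter (∁? (_∈? verts H)) (allFin (suc (n G)))

    edgesOutsideH : List (Fin (m G))
    edgesOutsideH = QuotientGraph.elist (quotient G H)

  vertex-count : length outsideH + ∣ verts H ∣ ≡ suc (n G)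
  vertex-count = begin
    length outsideH + ∣ verts H ∣
      ≡⟨ cong (λ k → length outsideH + k) (length-filter-tabulate (_∈? verts H) (verts H) id (λ _ → refl)) ⟨
    length outsideH + length (filter (_∈? verts H) (allFin (suc (n G))))
      ≡⟨ length-filter-∁+length-filter (_∈? verts H) (allFin (suc (n G))) ⟩
    length (allFin (suc (n G)))
      ≡⟨ length-tabulate id ⟩
    suc (n G) ∎

  edge-count : length edgesOutsideH + length (edgesH G H) ≡ m G
  edge-count = begin
    length edgesOutsideH + length (edgesH G H) ≡⟨ length-filter-∁+length-filter _ (allFin (m G)) ⟩
    length (allFin (m G))                      ≡⟨ length-tabulate id ⟩
    m G                                        ∎

  sizeQ+sizeSub≡1+size : sizeQ (quotient G H) + sizeSub G H ≡ suc (size G)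
  sizeQ+sizeSub≡1+size = begin
    sizeQ (quotient G H) + sizeSub G H
      ≡⟨ cong (λ v → suc (v + length edgesOutsideH) + sizeSub G H) (length-map just outsideH) ⟩
    suc ((length outsideH + length edgesOutsideH) + (∣ verts H ∣ + length (edgesH G H)))
      ≡⟨ cong suc (interchange (length outsideH) _ _ _) ⟩
    suc ((length outsideH + ∣ verts H ∣) + (length edgesOutsideH + length (edgesH G H)))
      ≡⟨ cong suc (cong₂ _+_ vertex-count edge-count) ⟩
    suc (size G) ∎

mainTheorem6 : (G : Graph) (H : FullSubgraph G) →
    logInd G H ≡ logIndTrivial G - logIndTrivialSub G H
mainTheorem6 G H =
  m+n≡1+k⇒m-1≡[k-1]-[n-1] {sizeQ (quotient G H)} {sizeSub G H} {size G}
    (sizeQ+sizeSub≡1+size G H)
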